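{- Let $n>1$ be a non-intersecting integer and let $p$ be the smallest prime dividing $n$. Then $n/p$ has fewer than $p$ distinct prime divisors.
   Context: Two congruences $a\bmod d$ and $a'\bmod d'$ overlap if some integer satisfies both. A set of congruences $\{a_1\bmod d_1,\ldots,a_t\bmod d_t\}$ is coprime disjoint (CD) if whenever $a_i\bmod d_i$ and $a_j\bmod d_j$ overlap for $i\neq j$, we have $\gcd(d_i,d_j)=1$. An integer $n$ is non-intersecting if there exist integers $\{a_d : d\mid n,\ d>1\}$ such that $\{a_d\bmod d : d\mid n,\ d>1\}$ is a CD congruence set (one congruence for each divisor $d>1$ of $n$). -}

module Defs where

open import Data.Nat using (ℕ; suc; _<_; _≤_)
open import Data.Nat.Divisibility using (_∣_; _∣?_)
open import Data.Nat.Primality using (Prime; prime?)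
open import Data.Nat.Coprimality using (Coprime)
open import Data.Integer as ℤ using (ℤ)
open import Data.List using (List; filter; upTo; length)
open import Data.Product using (∃; _×_)
open import Relation.Binary.PropositionalEquality using (_≢_)
open import Relation.Nullary.Decidable using (_×-dec_)

_≡_[mod_] : ℤ → ℤ → ℕ → Set
x ≡ a [mod d ] = d ∣ ℤ.∣ x ℤ.- a ∣

Overlap : ℤ → ℕ → ℤ → ℕ → Set
Overlap a d a' d' = ∃ λ (x : ℤ) → (x ≡ a [mod d ]) × (x ≡ a' [mod d' ])

-- n is non-intersecting: there is a choice of residues a_d, one for each
-- divisor d > 1 of n, such that the congruence set {a_d mod d} is CD:
-- any two distinct members that overlap have coprime moduli.
NonIntersecting : ℕ → Set
NonIntersecting n =
  ∃ λ (a : ℕ → ℤ) →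
    ∀ d d' → d ∣ n → 1 < d → d' ∣ n → 1 < d' → d ≢ d' →
      Overlap (a d) d (a d') d' → Coprime d d'

-- Number of distinct prime divisors of m (primes q ≤ m with q ∣ m; for m ≥ 1
-- every prime divisor is ≤ m).
ω : ℕ → ℕ
ω m = length (filter (λ q → prime? q ×-dec (q ∣? m)) (upTo (suc m)))

-- For q = 1 and for each prime q dividing m, p q divides n. Two distinct such q are
-- coprime, so by the Chinese remainder theorem the classes a_{pq} mod p q and
-- a_{pq'} mod p q' overlap whenever a_{pq} ≡ a_{pq'} (mod p); since p divides both
-- moduli, the CD property forbids this. Hence q ↦ a_{pq} mod p is injective on these
-- ω(m) + 1 values of q, and ω(m) + 1 ≤ p.
module Submission where

open import Defs
open import Data.Nat using (ℕ; _<_; _≤_; _*_)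
open import Data.Nat.Divisibility using (_∣_)
open import Data.Nat.Primality using (Prime)
open import Relation.Binary.PropositionalEquality using (_≡_)

open import Data.Nat as ℕ using (suc; NonZero; NonTrivial; _≟_)
import Data.Nat.Properties as ℕ
open import Data.Nat.Divisibility using (_∣?_; m∣m*n; *-monoˡ-∣; 1∣_)
open import Data.Nat.Primality using (prime?; prime⇒irreducible; prime⇒nonTrivial; prime⇒nonZero)
open import Data.Nat.Coprimality as Coprime using (Coprime; coprime-Bézout; 1-coprimeTo)
open import Data.Nat.GCD using (module Bézout)
open import Data.Integer as ℤ using (ℤ; +_; 1ℤ; _%ℕ_; _/ℕ_)
open import Data.Integer.Properties using (pos-*; pos-+)
import Data.Integer.Properties as ℤ
open import Data.Integer.DivMod using (a≡a%ℕn+[a/ℕn]*n; n%ℕd<d)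
open import Data.Integer.Divisibility.Signed using (divides; ∣ᵤ⇒∣; ∣⇒∣ᵤ)
open import Data.Integer.Tactic.RingSolver using (solve-∀)
open import Data.Fin using (Fin; zero; suc; toℕ; fromℕ<)
open import Data.Fin.Properties using (injective⇒≤; toℕ-fromℕ<)
open import Data.List using (List; _∷_; length; filter; upTo; lookup)
open import Data.List.Membership.Propositional using (_∈_)
open import Data.List.Membership.Propositional.Properties using (∈-lookup; ∈-filter⁻)
import Data.List.Relation.Unary.All as All
open import Data.List.Relation.Unary.Any using (here; there)
open import Data.List.Relation.Unary.Unique.Propositional using (Unique; _∷_)
import Data.List.Relation.Unary.Unique.Propositional.Properties as Unique
open import Data.Product using (_,_; proj₁; proj₂; ∃₂; _×_)
open import Data.Sum using (inj₁; inj₂)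
open import Data.Empty using (⊥-elim)
open import Function.Definitions using (Injective)
open import Relation.Nullary using (¬_; yes; no; contradiction)
open import Relation.Nullary.Decidable using (_×-dec_)
open import Relation.Unary using (Decidable)
open import Relation.Binary.PropositionalEquality
  using (_≢_; refl; sym; trans; cong; cong₂; subst₂; module ≡-Reasoning)

open ≡-Reasoning

1+yn≡xm⇒xm-yn≡1 : ∀ {x y m n} → 1 ℕ.+ y * n ≡ x * m → + x ℤ.* + m ℤ.+ ℤ.- + y ℤ.* + n ≡ 1ℤ
1+yn≡xm⇒xm-yn≡1 {x} {y} {m} {n} eq = begin
  + x ℤ.* + m ℤ.+ ℤ.- + y ℤ.* + n          ≡⟨ cong (ℤ._+ ℤ.- + y ℤ.* + n) xm≡1+yn ⟩
  1ℤ ℤ.+ + y ℤ.* + n ℤ.+ ℤ.- + y ℤ.* + n   ≡⟨ cancel (+ y) (+ n) ⟩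
  1ℤ                                      ∎
  where
  xm≡1+yn : + x ℤ.* + m ≡ 1ℤ ℤ.+ + y ℤ.* + n
  xm≡1+yn = begin
    + x ℤ.* + m         ≡⟨ pos-* x m ⟨
    + (x * m)           ≡⟨ cong +_ eq ⟨
    + (1 ℕ.+ y * n)     ≡⟨ pos-+ 1 (y * n) ⟩
    1ℤ ℤ.+ + (y * n)    ≡⟨ cong (ℤ._+_ 1ℤ) (pos-* y n) ⟩
    1ℤ ℤ.+ + y ℤ.* + n  ∎
  cancel : ∀ y n → 1ℤ ℤ.+ y ℤ.* n ℤ.+ ℤ.- y ℤ.* n ≡ 1ℤ
  cancel = solve-∀

coprime⇒bézoutℤ : ∀ {q q'} → Coprime q q' → ∃₂ λ u v → u ℤ.* + q ℤ.+ v ℤ.* + q' ≡ 1ℤ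
coprime⇒bézoutℤ {q} {q'} c with coprime-Bézout c
... | Bézout.+- x y eq = + x , ℤ.- + y , 1+yn≡xm⇒xm-yn≡1 {x} {y} {q} {q'} eq
... | Bézout.-+ x y eq = ℤ.- + x , + y , trans (ℤ.+-comm (ℤ.- + x ℤ.* + q) (+ y ℤ.* + q'))
                           (1+yn≡xm⇒xm-yn≡1 {y} {x} {q'} {q} eq)

%ℕ-≡⇒≡[mod] : ∀ a b p .{{_ : NonZero p}} → a %ℕ p ≡ b %ℕ p → b ≡ a [mod p ]
%ℕ-≡⇒≡[mod] a b p a%p≡b%p = ∣⇒∣ᵤ {+ p} (divides (b /ℕ p ℤ.- a /ℕ p) (begin
  b ℤ.- a
    ≡⟨ cong₂ ℤ._-_ (a≡a%ℕn+[a/ℕn]*n b p) (a≡a%ℕn+[a/ℕn]*n a p) ⟩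
  (+ (b %ℕ p) ℤ.+ b /ℕ p ℤ.* + p) ℤ.- (+ (a %ℕ p) ℤ.+ a /ℕ p ℤ.* + p)
    ≡⟨ cong (λ r → (+ r ℤ.+ b /ℕ p ℤ.* + p) ℤ.- (+ (a %ℕ p) ℤ.+ a /ℕ p ℤ.* + p)) a%p≡b%p ⟨
  (+ (a %ℕ p) ℤ.+ b /ℕ p ℤ.* + p) ℤ.- (+ (a %ℕ p) ℤ.+ a /ℕ p ℤ.* + p)
    ≡⟨ cancel (+ (a %ℕ p)) (b /ℕ p) (a /ℕ p) (+ p) ⟩
  (b /ℕ p ℤ.- a /ℕ p) ℤ.* + p ∎))
  where
  cancel : ∀ r s t p → (r ℤ.+ s ℤ.* p) ℤ.- (r ℤ.+ t ℤ.* p) ≡ (s ℤ.- t) ℤ.* p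
  cancel = solve-∀

≡[mod]⇒overlap : ∀ p {q q'} → Coprime q q' → ∀ {a b} → b ≡ a [mod p ] →
                 Overlap a (p * q) b (p * q')
≡[mod]⇒overlap p {q} {q'} q⊥q' {a} {b} b≡a
  with ∣ᵤ⇒∣ {+ p} b≡a | coprime⇒bézoutℤ q⊥q'
... | divides k b-a≡kp | u , v , uq+vq'≡1 =
  x , ∣⇒∣ᵤ {+ (p * q)} (divides (u ℤ.* k) x-a≡) , ∣⇒∣ᵤ {+ (p * q')} (divides (ℤ.- (v ℤ.* k)) x-b≡)
  where
  P = + p
  Q = + q
  Q' = + q'
  -- x = a + u q (b - a), where u q is ≡ 0 mod q and ≡ 1 mod q'.
  x : ℤ
  x = a ℤ.+ u ℤ.* Q ℤ.* (k ℤ.* P)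
  x-a≡ : x ℤ.- a ≡ u ℤ.* k ℤ.* + (p * q)
  x-a≡ = begin
    x ℤ.- a                   ≡⟨ rearrange a u Q k P ⟩
    u ℤ.* k ℤ.* (P ℤ.* Q)     ≡⟨ cong (u ℤ.* k ℤ.*_) (pos-* p q) ⟨
    u ℤ.* k ℤ.* + (p * q)     ∎
    where
    rearrange : ∀ a u Q k P → a ℤ.+ u ℤ.* Q ℤ.* (k ℤ.* P) ℤ.- a ≡ u ℤ.* k ℤ.* (P ℤ.* Q)
    rearrange = solve-∀
  uq≡1-vq' : u ℤ.* Q ≡ 1ℤ ℤ.- v ℤ.* Q'
  uq≡1-vq' = begin
    u ℤ.* Q                              ≡⟨ rearrange (u ℤ.* Q) (v ℤ.* Q') ⟩
    (u ℤ.* Q ℤ.+ v ℤ.* Q') ℤ.- v ℤ.* Q'  ≡⟨ cong (ℤ._- v ℤ.* Q') uq+vq'≡1 ⟩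
    1ℤ ℤ.- v ℤ.* Q'                      ∎
    where
    rearrange : ∀ s t → s ≡ (s ℤ.+ t) ℤ.- t
    rearrange = solve-∀
  x-b≡ : x ℤ.- b ≡ ℤ.- (v ℤ.* k) ℤ.* + (p * q')
  x-b≡ = begin
    x ℤ.- b                                  ≡⟨ shift a b (u ℤ.* Q) (k ℤ.* P) ⟩
    u ℤ.* Q ℤ.* (k ℤ.* P) ℤ.- (b ℤ.- a)      ≡⟨ cong (ℤ._-_ (u ℤ.* Q ℤ.* (k ℤ.* P))) b-a≡kp ⟩
    u ℤ.* Q ℤ.* (k ℤ.* P) ℤ.- k ℤ.* P        ≡⟨ cong (λ w → w ℤ.* (k ℤ.* P) ℤ.- k ℤ.* P) uq≡1-vq' ⟩
    (1ℤ ℤ.- v ℤ.* Q') ℤ.* (k ℤ.* P) ℤ.- k ℤ.* P ≡⟨ expand v Q' k P ⟩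
    ℤ.- (v ℤ.* k) ℤ.* (P ℤ.* Q')             ≡⟨ cong (ℤ.- (v ℤ.* k) ℤ.*_) (pos-* p q') ⟨
    ℤ.- (v ℤ.* k) ℤ.* + (p * q')             ∎
    where
    shift : ∀ a b s t → a ℤ.+ s ℤ.* t ℤ.- b ≡ s ℤ.* t ℤ.- (b ℤ.- a)
    shift = solve-∀
    expand : ∀ v Q' k P → (1ℤ ℤ.- v ℤ.* Q') ℤ.* (k ℤ.* P) ℤ.- k ℤ.* P ≡ ℤ.- (v ℤ.* k) ℤ.* (P ℤ.* Q')
    expand = solve-∀

lookup-injective : ∀ {A : Set} {xs : List A} → Unique xs →
                   ∀ i j → lookup xs i ≡ lookup xs j → i ≡ j
lookup-injective (_    ∷ _)   zero    zero    _  = refl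
lookup-injective (x∉xs ∷ _)   zero    (suc j) eq = contradiction eq (All.lookup x∉xs (∈-lookup j))
lookup-injective (x∉xs ∷ _)   (suc i) zero    eq = contradiction (sym eq) (All.lookup x∉xs (∈-lookup i))
lookup-injective (_    ∷ xs!) (suc i) (suc j) eq = cong suc (lookup-injective xs! i j eq)

injectiveOn⇒length≤ : ∀ {A : Set} {xs : List A} {p} (g : A → ℕ) → Unique xs →
                      (∀ {x} → x ∈ xs → g x < p) →
                      (∀ {x y} → x ∈ xs → y ∈ xs → g x ≡ g y → x ≡ y) →
                      length xs ≤ p
injectiveOn⇒length≤ {xs = xs} {p} g xs! g<p g-injective = injective⇒≤ f-injective
  where
  f : Fin (length xs) → Fin p
  f i = fromℕ< (g<p (∈-lookup i))
  f-injective : Injective _≡_ _≡_ f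
  f-injective {i} {j} fi≡fj = lookup-injective xs! i j
    (g-injective (∈-lookup i) (∈-lookup j) (begin
      g (lookup xs i)  ≡⟨ toℕ-fromℕ< (g<p (∈-lookup i)) ⟨
      toℕ (f i)        ≡⟨ cong toℕ fi≡fj ⟩
      toℕ (f j)        ≡⟨ toℕ-fromℕ< (g<p (∈-lookup j)) ⟩
      g (lookup xs j)  ∎))

prime⇒1< : ∀ {p} → Prime p → 1 < p
prime⇒1< {p} pp = ℕ.nonTrivial⇒n>1 p {{prime⇒nonTrivial pp}}

prime-≢⇒coprime : ∀ {q q'} → Prime q → Prime q' → q ≢ q' → Coprime q q'
prime-≢⇒coprime pq pq' q≢q' (d∣q , d∣q') with prime⇒irreducible pq d∣q
... | inj₁ d≡1 = d≡1
... | inj₂ refl with prime⇒irreducible pq' d∣q'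
...   | inj₁ d≡1  = d≡1
...   | inj₂ q≡q' = contradiction q≡q' q≢q'

primeDivisor? : ∀ m → Decidable (λ q → Prime q × q ∣ m)
primeDivisor? m q = prime? q ×-dec (q ∣? m)

primeDivisors : ℕ → List ℕ
primeDivisors m = filter (primeDivisor? m) (upTo (suc m))

∈-primeDivisors⁻ : ∀ {m q} → q ∈ primeDivisors m → Prime q × q ∣ m
∈-primeDivisors⁻ {m} q∈ = proj₂ (∈-filter⁻ (primeDivisor? m) {xs = upTo (suc m)} q∈)

1∷primeDivisors-unique : ∀ m → Unique (1 ∷ primeDivisors m)
1∷primeDivisors-unique m =
  All.tabulate (λ q∈ 1≡q → ℕ.<-irrefl 1≡q (prime⇒1< (proj₁ (∈-primeDivisors⁻ {m} q∈))))
  ∷ Unique.filter⁺ (primeDivisor? m) (Unique.upTo⁺ (suc m))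

∈-1∷primeDivisors⇒∣ : ∀ {m q} → q ∈ 1 ∷ primeDivisors m → q ∣ m
∈-1∷primeDivisors⇒∣ {m} (here refl) = 1∣ m
∈-1∷primeDivisors⇒∣ {m} (there q∈) = proj₂ (∈-primeDivisors⁻ {m} q∈)

∈-1∷primeDivisors⇒nonZero : ∀ {m q} → q ∈ 1 ∷ primeDivisors m → NonZero q
∈-1∷primeDivisors⇒nonZero (here refl) = _
∈-1∷primeDivisors⇒nonZero {m} (there q∈) = prime⇒nonZero (proj₁ (∈-primeDivisors⁻ {m} q∈))

1∷primeDivisors-coprime : ∀ {m q q'} → q ∈ 1 ∷ primeDivisors m → q' ∈ 1 ∷ primeDivisors m →
                          q ≢ q' → Coprime q q'
1∷primeDivisors-coprime (here refl) _           _     = 1-coprimeTo _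
1∷primeDivisors-coprime (there _)   (here refl) _     = Coprime.sym (1-coprimeTo _)
1∷primeDivisors-coprime {m} (there q∈)  (there q'∈) q≢q' =
  prime-≢⇒coprime (proj₁ (∈-primeDivisors⁻ {m} q∈)) (proj₁ (∈-primeDivisors⁻ {m} q'∈)) q≢q'

nonIntersecting⇒residues-distinct :
  ∀ {n p q q'} (ni : NonIntersecting n) .{{_ : NonTrivial p}} .{{_ : NonZero q}} .{{_ : NonZero q'}} →
  p * q ∣ n → p * q' ∣ n → Coprime q q' → q ≢ q' →
  ¬ (proj₁ ni (p * q') ≡ proj₁ ni (p * q) [mod p ])
nonIntersecting⇒residues-distinct {n} {p} {q} {q'} (a , cd) pq∣n pq'∣n q⊥q' q≢q' a'≡a =
  ℕ.<-irrefl (sym p≡1) 1<p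
  where
  instance _ = ℕ.nonTrivial⇒nonZero p
  1<p : 1 < p
  1<p = ℕ.nonTrivial⇒n>1 p
  1<p* : ∀ r .{{_ : NonZero r}} → 1 < p * r
  1<p* r = ℕ.<-≤-trans 1<p (ℕ.m≤m*n p r)
  pq⊥pq' : Coprime (p * q) (p * q')
  pq⊥pq' = cd (p * q) (p * q') pq∣n (1<p* q) pq'∣n (1<p* q')
              (λ pq≡pq' → q≢q' (ℕ.*-cancelˡ-≡ q q' p pq≡pq'))
              (≡[mod]⇒overlap p q⊥q' a'≡a)
  p≡1 : p ≡ 1
  p≡1 = pq⊥pq' (m∣m*n q , m∣m*n q')

lemma3 : (n p m : ℕ) → 1 < n → NonIntersecting n →
         Prime p → p ∣ n → (∀ q → Prime q → q ∣ n → p ≤ q) →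
         n ≡ m * p → ω m < p
lemma3 n p m _ ni pp _ _ n≡m*p =
  injectiveOn⇒length≤ residue (1∷primeDivisors-unique m)
    (λ {q} _ → n%ℕd<d (proj₁ ni (p * q)) p) residue-injective
  where
  instance _ = prime⇒nonZero pp
  residue : ℕ → ℕ
  residue q = proj₁ ni (p * q) %ℕ p
  p*-∣n : ∀ {q} → q ∈ 1 ∷ primeDivisors m → p * q ∣ n
  p*-∣n {q} q∈ = subst₂ _∣_ (ℕ.*-comm q p) (sym n≡m*p) (*-monoˡ-∣ p (∈-1∷primeDivisors⇒∣ {m} q∈))
  residue-injective : ∀ {q q'} → q ∈ 1 ∷ primeDivisors m → q' ∈ 1 ∷ primeDivisors m →
                      residue q ≡ residue q' → q ≡ q'
  residue-injective {q} {q'} q∈ q'∈ residues≡ with q ≟ q'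
  ... | yes q≡q' = q≡q'
  ... | no q≢q'  = ⊥-elim (nonIntersecting⇒residues-distinct ni
        {{prime⇒nonTrivial pp}}
        {{∈-1∷primeDivisors⇒nonZero {m} q∈}} {{∈-1∷primeDivisors⇒nonZero {m} q'∈}}
        (p*-∣n q∈) (p*-∣n q'∈) (1∷primeDivisors-coprime {m} q∈ q'∈ q≢q') q≢q'
        (%ℕ-≡⇒≡[mod] (proj₁ ni (p * q)) (proj₁ ni (p * q')) p residues≡))
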